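{- Let $X,Y,b,g,h,l,w$ be integers and put $U=2lXY$, $V=4gwY$, $A=U(V+1)$, $B=2X+1$, $C=B+(A-2)h$. If $|Y|\ge2$ and $(2A-5)\mid\big(3bwC-2(b^2w^2-1)\big)$, then $bw\neq0$. -}

module Defs where

-- If b w = 0 the divisibility says that 2A − 5 divides 2. As A = U (V + 1) with U = 2 l X Y,
-- 2A − 5 = 4 m − 5 with m = l X Y (V + 1); an integer of this shape divides 2 only when it is −1,
-- i.e. m = 1, and then Y divides 1, contradicting |Y| ≥ 2.
module Submission where

open import Defs
open import Data.Integer using (ℤ; _+_; _-_; _*_; ∣_∣; +_; -_; +[1+_]; -[1+_])
open import Data.Integer.Divisibility using (_∣_)
open import Data.Integer.Properties using (abs-*; ∣-i∣≡∣i∣; pos-*; _≟_)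
open import Data.Integer.Tactic.RingSolver using (solve-∀)
open import Data.Nat using (_≥_; s≤s; z≤n)
import Data.Nat as ℕ
import Data.Nat.Divisibility as ℕ
open import Data.Nat.Properties using (m*n≡1⇒n≡1; <⇒≱)
open import Relation.Binary.PropositionalEquality
  using (_≡_; _≢_; refl; sym; trans; cong; subst; subst₂; module ≡-Reasoning)
open import Relation.Nullary using (yes; no; contradiction)

i*j≡1⇒∣j∣≡1 : ∀ i j → i * j ≡ + 1 → ∣ j ∣ ≡ 1
i*j≡1⇒∣j∣≡1 i j eq = m*n≡1⇒n≡1 ∣ i ∣ ∣ j ∣ (trans (sym (abs-* i j)) (cong ∣_∣ eq))

2<∣4m-5∣ : ∀ m → m ≢ + 1 → 2 ℕ.< ∣ + 4 * m - + 5 ∣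
2<∣4m-5∣ (+ 0)           _   = s≤s (s≤s (s≤s z≤n))
2<∣4m-5∣ (+ 1)           m≢1 = contradiction refl m≢1
2<∣4m-5∣ +[1+ ℕ.suc n ] _   = begin-strict
  2                                     <⟨ s≤s (s≤s (s≤s z≤n)) ⟩
  ∣ + 3 + + (4 ℕ.* n) ∣                 ≡⟨ cong (λ i → ∣ + 3 + i ∣) (pos-* 4 n) ⟩
  ∣ + 3 + + 4 * + n ∣                   ≡⟨ cong ∣_∣ (sym (4[2+k]-5 (+ n))) ⟩
  ∣ + 4 * +[1+ ℕ.suc n ] - + 5 ∣        ∎
  where
  open Data.Nat.Properties.≤-Reasoning
  4[2+k]-5 : ∀ k → + 4 * (+ 2 + k) - + 5 ≡ + 3 + + 4 * k
  4[2+k]-5 = solve-∀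
2<∣4m-5∣ -[1+ n ]        _   = begin-strict
  2                                     <⟨ s≤s (s≤s (s≤s z≤n)) ⟩
  ∣ + 5 + + 4 * + (ℕ.suc n) ∣           ≡⟨ ∣-i∣≡∣i∣ (+ 5 + + 4 * + (ℕ.suc n)) ⟨
  ∣ - (+ 5 + + 4 * + (ℕ.suc n)) ∣       ≡⟨ cong ∣_∣ (sym (4[-k]-5 (+ ℕ.suc n))) ⟩
  ∣ + 4 * -[1+ n ] - + 5 ∣              ∎
  where
  open Data.Nat.Properties.≤-Reasoning
  4[-k]-5 : ∀ k → + 4 * (- k) - + 5 ≡ - (+ 5 + + 4 * k)
  4[-k]-5 = solve-∀

4m-5∣2⇒m≡1 : ∀ m → (+ 4 * m - + 5) ∣ + 2 → m ≡ + 1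
4m-5∣2⇒m≡1 m 4m-5∣2 with m ≟ + 1
... | yes m≡1 = m≡1
... | no  m≢1 = contradiction 4m-5∣2 (ℕ.>⇒∤ (2<∣4m-5∣ m m≢1))

bw≡0⇒3bwC-2[b²w²-1]≡2 : ∀ b w C → b * w ≡ + 0 →
                          + 3 * b * w * C - + 2 * (b * b * w * w - + 1) ≡ + 2
bw≡0⇒3bwC-2[b²w²-1]≡2 b w C bw≡0 = begin
  + 3 * b * w * C - + 2 * (b * b * w * w - + 1)          ≡⟨ regroup b w C ⟩
  + 3 * (b * w) * C - + 2 * ((b * w) * (b * w) - + 1)  ≡⟨ cong (λ t → + 3 * t * C - + 2 * (t * t - + 1)) bw≡0 ⟩
  + 2                                                  ∎
  where
  open ≡-Reasoning
  regroup : ∀ b w C → + 3 * b * w * C - + 2 * (b * b * w * w - + 1)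
                    ≡ + 3 * (b * w) * C - + 2 * ((b * w) * (b * w) - + 1)
  regroup = solve-∀

lemma4p5 : ∀ (X Y b g h l w : ℤ) →
    let U = + 2 * l * X * Y
        V = + 4 * g * w * Y
        A = U * (V + + 1)
        B = + 2 * X + + 1
        C = B + (A - + 2) * h
    in ∣ Y ∣ ≥ 2 →
       (+ 2 * A - + 5) ∣ (+ 3 * b * w * C - + 2 * (b * b * w * w - + 1)) →
       b * w ≢ + 0
lemma4p5 X Y b g h l w ∣Y∣≥2 2A-5∣[…] bw≡0 = <⇒≱ ∣Y∣<2 ∣Y∣≥2
  where
  W = + 4 * g * w * Y + + 1
  A = + 2 * l * X * Y * W
  C = + 2 * X + + 1 + (A - + 2) * h
  m = l * X * W * Y

  2A-5≡4m-5 : + 2 * A - + 5 ≡ + 4 * m - + 5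
  2A-5≡4m-5 = regroup l X Y W
    where
    regroup : ∀ l X Y W → + 2 * (+ 2 * l * X * Y * W) - + 5 ≡ + 4 * (l * X * W * Y) - + 5
    regroup = solve-∀

  ∣Y∣<2 : ∣ Y ∣ ℕ.< 2
  ∣Y∣<2 = subst (ℕ._< 2) (sym ∣Y∣≡1) (s≤s (s≤s z≤n))
    where
    4m-5∣2 : (+ 4 * m - + 5) ∣ + 2
    4m-5∣2 = subst₂ _∣_ 2A-5≡4m-5 (bw≡0⇒3bwC-2[b²w²-1]≡2 b w C bw≡0) 2A-5∣[…]
    ∣Y∣≡1 : ∣ Y ∣ ≡ 1
    ∣Y∣≡1 = i*j≡1⇒∣j∣≡1 (l * X * W) Y (4m-5∣2⇒m≡1 m 4m-5∣2)
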